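{- Let $A$ be a finite algebra and $\Gamma$ its power graph. Suppose that $\Gamma$ is equal to the enhanced power graph of $A$, or that $\Gamma$ is equal to the intersection power graph of $A$. Then $\Gamma$ is a cograph and a chordal graph.
   Context: An algebra is a set $A$ with a collection of operations of various finite arities (nullary operations give constants). For $S\subseteq A$, $\langle S\rangle$ is the subalgebra generated by $S$; $\langle x\rangle=\langle\{x\}\rangle$. $E(A)=\langle\emptyset\rangle$ is the smallest subalgebra (possibly empty). Graphs are simple with vertex set $A$. Power graph: distinct $x,y$ adjacent iff $x\in\langle y\rangle$ or $y\in\langle x\rangle$. Enhanced power graph: distinct $x,y$ adjacent iff there is $z\in A$ with $x,y\in\langle z\rangle$. Intersection power graph: distinct $x,y$ adjacent iff $x\in E(A)$ or $y\in E(A)$ or $\langle x\rangle\cap\langle y\rangle$ properly contains $E(A)$. A cograph is a graph with no induced subgraph isomorphic to the path on $4$ vertices. A chordal graph is a graph with no induced cycle of length greater than $3$. -}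

module Defs where

open import Data.Nat using (ℕ; suc; _+_; _<_)
open import Data.Fin using (Fin; toℕ)
open import Data.Empty using (⊥)
open import Data.Product using (Σ; _×_; ∃)
open import Data.Sum using (_⊎_)
open import Relation.Nullary using (¬_)
open import Relation.Binary.PropositionalEquality using (_≡_; _≢_)
open import Function.Bundles using (_⇔_)

record FiniteAlgebra : Set₁ where
  field
    size  : ℕ
    Op    : Set
    arity : Op → ℕ
    apply : (o : Op) → (Fin (arity o) → Fin size) → Fin size

  Carrier : Set
  Carrier = Fin size

  -- Membership in the subalgebra ⟨S⟩ generated by S: the least subset
  -- containing S and closed under all operations (nullary ones give constants).
  data ⟨_⟩∋_ (S : Carrier → Set) : Carrier → Set where
    gen : ∀ {x} → S x → ⟨ S ⟩∋ x
    app : (o : Op) (args : Fin (arity o) → Carrier) →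
          (∀ k → ⟨ S ⟩∋ args k) → ⟨ S ⟩∋ apply o args

  _∈⟨_⟩ : Carrier → Carrier → Set
  x ∈⟨ y ⟩ = ⟨ (λ z → z ≡ y) ⟩∋ x

  _∈E : Carrier → Set
  x ∈E = ⟨ (λ _ → ⊥) ⟩∋ x

  PowerAdj : Carrier → Carrier → Set
  PowerAdj x y = x ≢ y × (x ∈⟨ y ⟩ ⊎ y ∈⟨ x ⟩)

  EnhancedAdj : Carrier → Carrier → Set
  EnhancedAdj x y = x ≢ y × ∃ (λ z → x ∈⟨ z ⟩ × y ∈⟨ z ⟩)

  -- Intersection power graph adjacency. Since E(A) ⊆ ⟨x⟩ ∩ ⟨y⟩ always,
  -- "⟨x⟩ ∩ ⟨y⟩ properly contains E(A)" means some w ∈ ⟨x⟩ ∩ ⟨y⟩ lies outside E(A).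
  IntersectionAdj : Carrier → Carrier → Set
  IntersectionAdj x y =
    x ≢ y × (x ∈E ⊎ (y ∈E ⊎ ∃ (λ w → w ∈⟨ x ⟩ × (w ∈⟨ y ⟩ × ¬ (w ∈E)))))

SameGraph : {V : Set} → (V → V → Set) → (V → V → Set) → Set
SameGraph {V} R S = ∀ (x y : V) → R x y ⇔ S x y

InducedP4 : {V : Set} → (V → V → Set) → Set
InducedP4 {V} Adj = Σ V λ a → Σ V λ b → Σ V λ c → Σ V λ d →
  (a ≢ b × a ≢ c × a ≢ d × b ≢ c × b ≢ d × c ≢ d) ×
  (Adj a b × Adj b c × Adj c d) ×
  (¬ Adj a c × ¬ Adj a d × ¬ Adj b d)

IsCograph : {V : Set} → (V → V → Set) → Set
IsCograph Adj = ¬ InducedP4 Adj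

CycAdj : (k : ℕ) → Fin k → Fin k → Set
CycAdj k i j = (suc (toℕ i) ≡ toℕ j) ⊎ ((suc (toℕ j) ≡ toℕ i) ⊎
  ((suc (toℕ i) ≡ k × toℕ j ≡ 0) ⊎ (suc (toℕ j) ≡ k × toℕ i ≡ 0)))

InducedCycle : {V : Set} → (V → V → Set) → ℕ → Set
InducedCycle {V} Adj k = Σ (Fin k → V) λ v →
  (∀ i j → v i ≡ v j → i ≡ j) ×
  (∀ i j → i ≢ j → (Adj (v i) (v j) ⇔ CycAdj k i j))

IsChordal : {V : Set} → (V → V → Set) → Set
IsChordal Adj = ∀ k → 3 < k → ¬ InducedCycle Adj k

-- The power graph of an algebra is the comparability graph of the preorder
-- x ≼ y :⇔ x ∈ ⟨y⟩. In a comparability graph, the middle vertex b of an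
-- induced path a – b – c is either a peak (a, c ≼ b) or a valley (b ≼ a, c),
-- and in a path a – b – c – d missing the chords ac and bd one of b, c is a
-- peak and the other a valley. If the power graph equals the enhanced power
-- graph there are no peaks, since a, c ∈ ⟨b⟩ makes a, c adjacent. If it equals
-- the intersection power graph there are no valleys outside E(A), since
-- b ∈ ⟨a⟩ ∩ ⟨c⟩ makes a, c adjacent; and a vertex of E(A) is adjacent to
-- everything, whereas both middle vertices have a non-neighbour. Either way
-- no such path exists, and both an induced P4 and an induced cycle of length
-- at least 4 would contain one.
module Submission where

open import Defs
open import Data.Product using (_×_; _,_)
open import Data.Sum using (_⊎_; inj₁; inj₂)
open import Data.Nat using (suc; s≤s)
open import Data.Fin using (Fin)
import Data.Fin as Fin
open import Data.Empty using (⊥-elim)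
open import Relation.Nullary using (¬_)
open import Relation.Binary.Definitions using (Transitive)
open import Relation.Binary.PropositionalEquality using (_≡_; refl; _≢_; ≢-sym)
open import Function.Bundles using (Equivalence)

-- The chord a – d is unconstrained.
record OpenPath4 {V : Set} (Adj : V → V → Set) (a b c d : V) : Set where
  constructor openPath4
  field
    adjᵃᵇ : Adj a b
    adjᵇᶜ : Adj b c
    adjᶜᵈ : Adj c d
    a≢c   : a ≢ c
    b≢d   : b ≢ d
    ¬adjᵃᶜ : ¬ Adj a c
    ¬adjᵇᵈ : ¬ Adj b d

NoOpenPath4 : {V : Set} → (V → V → Set) → Set
NoOpenPath4 Adj = ∀ {a b c d} → ¬ OpenPath4 Adj a b c d

module _ {V : Set} {Adj : V → V → Set} (noPath : NoOpenPath4 Adj) where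

  noOpenPath4⇒cograph : IsCograph Adj
  noOpenPath4⇒cograph
    (_ , _ , _ , _ , (_ , a≢c , _ , _ , b≢d , _) , (ab , bc , cd) , (¬ac , _ , ¬bd)) =
    noPath (openPath4 ab bc cd a≢c b≢d ¬ac ¬bd)

  noOpenPath4⇒chordal : IsChordal Adj
  noOpenPath4⇒chordal 0 () _
  noOpenPath4⇒chordal 1 (s≤s ()) _
  noOpenPath4⇒chordal 2 (s≤s (s≤s ())) _
  noOpenPath4⇒chordal 3 (s≤s (s≤s (s≤s ()))) _
  noOpenPath4⇒chordal (suc (suc (suc (suc m)))) _ (v , v-injective , v-adj) =
    noPath (openPath4 (consecutive i₀ i₁ (λ ()) refl) (consecutive i₁ i₂ (λ ()) refl)
                      (consecutive i₂ i₃ (λ ()) refl)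
                      (λ eq → i₀≢i₂ (v-injective i₀ i₂ eq)) (λ eq → i₁≢i₃ (v-injective i₁ i₃ eq))
                      (λ adj → i₀≁i₂ (Equivalence.to (v-adj i₀ i₂ (λ ())) adj))
                      (λ adj → i₁≁i₃ (Equivalence.to (v-adj i₁ i₃ (λ ())) adj)))
    where
      i₀ i₁ i₂ i₃ : Fin (suc (suc (suc (suc m))))
      i₀ = Fin.zero
      i₁ = Fin.suc Fin.zero
      i₂ = Fin.suc (Fin.suc Fin.zero)
      i₃ = Fin.suc (Fin.suc (Fin.suc Fin.zero))

      consecutive : ∀ i j → i ≢ j → suc (Fin.toℕ i) ≡ Fin.toℕ j → Adj (v i) (v j)
      consecutive i j i≢j i+1≡j = Equivalence.from (v-adj i j i≢j) (inj₁ i+1≡j)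

      i₀≢i₂ : i₀ ≢ i₂
      i₀≢i₂ ()

      i₁≢i₃ : i₁ ≢ i₃
      i₁≢i₃ ()

      i₀≁i₂ : ¬ CycAdj _ i₀ i₂
      i₀≁i₂ (inj₁ ())
      i₀≁i₂ (inj₂ (inj₁ ()))
      i₀≁i₂ (inj₂ (inj₂ (inj₁ (() , _))))
      i₀≁i₂ (inj₂ (inj₂ (inj₂ (() , _))))

      i₁≁i₃ : ¬ CycAdj _ i₁ i₃
      i₁≁i₃ (inj₁ ())
      i₁≁i₃ (inj₂ (inj₁ ()))
      i₁≁i₃ (inj₂ (inj₂ (inj₁ (() , _))))
      i₁≁i₃ (inj₂ (inj₂ (inj₂ (_ , ()))))

module Comparability {V : Set} (_≼_ : V → V → Set) (≼-trans : Transitive _≼_) where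

  Comparable : V → V → Set
  Comparable x y = x ≢ y × (x ≼ y ⊎ y ≼ x)

  Peak Valley : V → V → V → Set
  Peak a b c = a ≼ b × c ≼ b
  Valley a b c = b ≼ a × b ≼ c

  comparable-sym : ∀ {x y} → Comparable x y → Comparable y x
  comparable-sym (x≢y , inj₁ x≼y) = ≢-sym x≢y , inj₂ x≼y
  comparable-sym (x≢y , inj₂ y≼x) = ≢-sym x≢y , inj₁ y≼x

  incomparable-sym : ∀ {x y} → ¬ Comparable x y → ¬ Comparable y x
  incomparable-sym ¬xy yx = ¬xy (comparable-sym yx)

  inducedPath3-peak⊎valley : ∀ {a b c} → Comparable a b → Comparable b c →
    a ≢ c → ¬ Comparable a c → Peak a b c ⊎ Valley a b c
  inducedPath3-peak⊎valley (_ , inj₁ a≼b) (_ , inj₁ b≼c) a≢c ¬ac = ⊥-elim (¬ac (a≢c , inj₁ (≼-trans a≼b b≼c)))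
  inducedPath3-peak⊎valley (_ , inj₁ a≼b) (_ , inj₂ c≼b) _   _   = inj₁ (a≼b , c≼b)
  inducedPath3-peak⊎valley (_ , inj₂ b≼a) (_ , inj₁ b≼c) _   _   = inj₂ (b≼a , b≼c)
  inducedPath3-peak⊎valley (_ , inj₂ b≼a) (_ , inj₂ c≼b) a≢c ¬ac = ⊥-elim (¬ac (a≢c , inj₂ (≼-trans c≼b b≼a)))

  openPath4-valley×peak⊎peak×valley : ∀ {a b c d} → OpenPath4 Comparable a b c d →
    (Valley a b c × Peak b c d) ⊎ (Peak a b c × Valley b c d)
  openPath4-valley×peak⊎peak×valley (openPath4 ab bc cd a≢c b≢d ¬ac ¬bd)
    with inducedPath3-peak⊎valley ab bc a≢c ¬ac | inducedPath3-peak⊎valley bc cd b≢d ¬bd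
  ... | inj₂ valley      | inj₁ peak            = inj₁ (valley , peak)
  ... | inj₁ peak        | inj₂ valley          = inj₂ (peak , valley)
  ... | inj₂ (_ , b≼c)   | inj₂ (_ , c≼d)       = ⊥-elim (¬bd (b≢d , inj₁ (≼-trans b≼c c≼d)))
  ... | inj₁ (a≼b , _)   | inj₁ (b≼c , _)       = ⊥-elim (¬ac (a≢c , inj₁ (≼-trans a≼b b≼c)))

module PowerGraph (A : FiniteAlgebra) where
  open FiniteAlgebra A

  ∈⟨⟩-trans : Transitive _∈⟨_⟩
  ∈⟨⟩-trans (gen refl)        y∈⟨z⟩ = y∈⟨z⟩
  ∈⟨⟩-trans (app o args args∈) y∈⟨z⟩ = app o args (λ k → ∈⟨⟩-trans (args∈ k) y∈⟨z⟩)

  open Comparability _∈⟨_⟩ ∈⟨⟩-trans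

  module _ (power≡enhanced : SameGraph PowerAdj EnhancedAdj) where

    enhanced⇒¬peak : ∀ {a b c} → a ≢ c → ¬ PowerAdj a c → ¬ Peak a b c
    enhanced⇒¬peak a≢c ¬ac (a∈⟨b⟩ , c∈⟨b⟩) =
      ¬ac (Equivalence.from (power≡enhanced _ _) (a≢c , _ , a∈⟨b⟩ , c∈⟨b⟩))

    enhanced⇒noOpenPath4 : NoOpenPath4 PowerAdj
    enhanced⇒noOpenPath4 path@(openPath4 _ _ _ a≢c b≢d ¬ac ¬bd)
      with openPath4-valley×peak⊎peak×valley path
    ... | inj₁ (_ , peak) = enhanced⇒¬peak b≢d ¬bd peak
    ... | inj₂ (peak , _) = enhanced⇒¬peak a≢c ¬ac peak

  module _ (power≡intersection : SameGraph PowerAdj IntersectionAdj) where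

    intersection⇒∉E : ∀ {x y} → x ≢ y → ¬ PowerAdj x y → ¬ x ∈E
    intersection⇒∉E x≢y ¬xy x∈E = ¬xy (Equivalence.from (power≡intersection _ _) (x≢y , inj₁ x∈E))

    intersection⇒¬valley : ∀ {a b c} → a ≢ c → ¬ PowerAdj a c → ¬ b ∈E → ¬ Valley a b c
    intersection⇒¬valley a≢c ¬ac b∉E (b∈⟨a⟩ , b∈⟨c⟩) =
      ¬ac (Equivalence.from (power≡intersection _ _) (a≢c , inj₂ (inj₂ (_ , b∈⟨a⟩ , b∈⟨c⟩ , b∉E))))

    intersection⇒noOpenPath4 : NoOpenPath4 PowerAdj
    intersection⇒noOpenPath4 path@(openPath4 _ _ _ a≢c b≢d ¬ac ¬bd)
      with openPath4-valley×peak⊎peak×valley path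
    ... | inj₁ (valley , _) =
      intersection⇒¬valley a≢c ¬ac (intersection⇒∉E b≢d ¬bd) valley
    ... | inj₂ (_ , valley) =
      intersection⇒¬valley b≢d ¬bd (intersection⇒∉E (≢-sym a≢c) (incomparable-sym ¬ac)) valley

  noOpenPath4 : SameGraph PowerAdj EnhancedAdj ⊎ SameGraph PowerAdj IntersectionAdj →
    NoOpenPath4 PowerAdj
  noOpenPath4 (inj₁ power≡enhanced)     = enhanced⇒noOpenPath4 power≡enhanced
  noOpenPath4 (inj₂ power≡intersection) = intersection⇒noOpenPath4 power≡intersection

mainTheorem2 : (A : FiniteAlgebra) →
    let open FiniteAlgebra A in
    (SameGraph PowerAdj EnhancedAdj ⊎ SameGraph PowerAdj IntersectionAdj) →
    IsCograph PowerAdj × IsChordal PowerAdj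
mainTheorem2 A hyp = noOpenPath4⇒cograph noPath , noOpenPath4⇒chordal noPath
  where
    noPath : NoOpenPath4 (FiniteAlgebra.PowerAdj A)
    noPath = PowerGraph.noOpenPath4 A hyp
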